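{- Let $w_1,\dots,w_n\in[1,u]$ be positive integers and let $\sigma$ be any lexical order on $\{1,\dots,n\}$. For any feasible target $j$, the lexicographically smallest solution $\mathsf{sol}(j,\sigma)$ of $j$ under $\sigma$ satisfies $|\mathsf{supp}(\mathsf{sol}(j,\sigma))|\le \log_2 u+1$. Consequently, for every residue $r\in[0,w_1-1]$ for which some feasible sum is congruent to $r$ modulo $w_1$, the lexicographically smallest solution under $\sigma$ of the minimum feasible sum $s\equiv r\pmod{w_1}$ has support size at most $\log_2 u+1$.
   Context: (Unbounded SubsetSum setting.) A solution to a sum $c$ is a vector $m=(m_1,\dots,m_n)\in\mathbb{N}^n$ with $\sum_i w_im_i=c$; $c$ is feasible if a solution exists. The support of $m$ is $\mathsf{supp}(m)=\{i\mid m_i>0\}$. A lexical order $\sigma=(\sigma_1,\dots,\sigma_n)$ is a permutation of $\{1,\dots,n\}$. For solutions $A=(a_1,\dots,a_n)$, $B=(b_1,\dots,b_n)$, $A$ is lexicographically smaller than $B$ under $\sigma$ if there is $j$ such that $a_{\sigma_k}=b_{\sigma_k}$ for all $k<j$ and $a_{\sigma_j}>b_{\sigma_j}$. $\mathsf{sol}(j,\sigma)$ denotes the lexicographically smallest solution to $j$ under $\sigma$ (all solutions are considered optimal in this setting). -}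

module Defs where

open import Data.Nat using (ℕ; zero; suc; _+_; _*_; _≤_; _<_)
open import Data.Fin as Fin using (Fin)
open import Data.Fin.Permutation using (Permutation′; _⟨$⟩ʳ_)
open import Data.Fin.Subset using (Subset)
open import Data.Vec using (tabulate)
open import Data.Bool using (Bool; true; false)
open import Data.Product using (Σ; ∃; _×_)
open import Data.Sum using (_⊎_)
open import Relation.Binary.PropositionalEquality using (_≡_)

weightedSum : ∀ {n} → (Fin n → ℕ) → (Fin n → ℕ) → ℕ
weightedSum {zero}  w m = 0
weightedSum {suc n} w m = w Fin.zero * m Fin.zero + weightedSum (λ i → w (Fin.suc i)) (λ i → m (Fin.suc i))

IsSolution : ∀ {n} → (Fin n → ℕ) → ℕ → (Fin n → ℕ) → Set
IsSolution w c m = weightedSum w m ≡ c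

Feasible : ∀ {n} → (Fin n → ℕ) → ℕ → Set
Feasible w c = ∃ λ m → IsSolution w c m

isPos : ℕ → Bool
isPos zero    = false
isPos (suc _) = true

supp : ∀ {n} → (Fin n → ℕ) → Subset n
supp m = tabulate (λ i → isPos (m i))

LexSmaller : ∀ {n} → Permutation′ n → (Fin n → ℕ) → (Fin n → ℕ) → Set
LexSmaller σ A B =
  ∃ λ j → ((k : Fin _) → k Fin.< j → A (σ ⟨$⟩ʳ k) ≡ B (σ ⟨$⟩ʳ k))
        × B (σ ⟨$⟩ʳ j) < A (σ ⟨$⟩ʳ j)

IsLexSmallestSol : ∀ {n} → (Fin n → ℕ) → Permutation′ n → ℕ → (Fin n → ℕ) → Set
IsLexSmallestSol w σ c m =
  IsSolution w c m ×
  ((B : Fin _ → ℕ) → IsSolution w c B → (∀ i → B i ≡ m i) ⊎ LexSmaller σ m B)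

-- Let m be the lexicographically smallest solution, p the σ-first index with m_p > 0
-- and A = supp m ∖ {p}. If two subsets D ≠ E of A had weight sums congruent modulo
-- w_p, say w(D) = w(E) + b·w_p, then m − 1_D + 1_E + b·1_p would be another solution.
-- It agrees with m before p and exceeds it at p unless b = 0; and when b = 0 the
-- exchange works in both directions, and one of the two results exceeds m at the
-- first index where D and E differ. Hence the 2^|A| subsets of A have distinct
-- weight sums modulo w_p ≤ u, i.e. |A| ≤ log₂ u.
module Submission where

open import Defs
open import Data.Nat using (ℕ; _+_; _*_; _≤_; _<_)
open import Data.Nat.Logarithm using (⌊log₂_⌋)
open import Data.Fin using (Fin; fromℕ<)
open import Data.Fin.Permutation using (Permutation′)
open import Data.Fin.Subset using (∣_∣)
open import Data.Product using (∃; _×_)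
open import Relation.Binary.PropositionalEquality using (_≡_)

open import Data.Nat using (zero; suc; _∸_; _^_; z≤n; s≤s; NonZero; >-nonZero; _%_; _/_)
open import Data.Nat.Properties
open import Algebra.Properties.Semiring.Sum +-*-semiring using (sum; sum-cong-≗; ∑-distrib-+)
open import Data.Nat.DivMod using (m≡m%n+[m/n]*n; _mod_)
open import Data.Nat.Logarithm using (⌊log₂⌋-mono-≤; ⌊log₂[2^n]⌋≡n)
open import Data.Fin as Fin using (zero; suc; toℕ; finToFun; funToFin; combine)
open import Data.Fin.Properties
  using (toℕ-injective; toℕ-fromℕ<; toℕ-inject; toℕ≤pred[n]; all?; ¬∀⟶∃¬-smallest;
         injective⇒≤; funToFin-finToFin)
  renaming (<-cmp to <-cmpᶠ)
open import Data.Fin.Permutation using (_⟨$⟩ʳ_; _⟨$⟩ˡ_; inverseʳ)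
open import Data.Fin.Subset using (Subset; _∈_; _∉_; _-_; ⁅_⁆; inside; outside)
open import Data.Fin.Subset.Properties using (_∈?_; p─q⊆p; p─⊥≡p; Empty-unique; ∣⊥∣≡0)
open import Data.Vec using (_∷_; here; there)
open import Data.Vec.Properties using ([]=⇒lookup; lookup⇒[]=; lookup∘tabulate)
open import Data.Bool using (true)
open import Data.Product using (_,_; proj₁; proj₂)
open import Data.Sum using (_⊎_; inj₁; inj₂)
open import Function using (_∘_)
open import Relation.Binary using (tri<; tri≈; tri>)
open import Relation.Binary.PropositionalEquality using (refl; sym; trans; cong; cong₂; subst; module ≡-Reasoning)
open import Relation.Nullary using (¬_; yes; no; contradiction)
open import Relation.Unary using (Pred; Decidable)

private
  variable
    n : ℕ

weightedSum≡sum : (w m : Fin n → ℕ) → weightedSum w m ≡ sum (λ i → w i * m i)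
weightedSum≡sum {zero}  w m = refl
weightedSum≡sum {suc n} w m = cong (w zero * m zero +_) (weightedSum≡sum (w ∘ suc) (m ∘ suc))

weightedSum-cong : (w : Fin n → ℕ) {f g : Fin n → ℕ} → (∀ i → f i ≡ g i) →
                   weightedSum w f ≡ weightedSum w g
weightedSum-cong {zero}  w f≗g = refl
weightedSum-cong {suc n} w f≗g = cong₂ _+_ (cong (w zero *_) (f≗g zero)) (weightedSum-cong (w ∘ suc) (f≗g ∘ suc))

weightedSum-+ : (w f g : Fin n → ℕ) →
                weightedSum w (λ i → f i + g i) ≡ weightedSum w f + weightedSum w g
weightedSum-+ w f g = begin
  weightedSum w (λ i → f i + g i)         ≡⟨ weightedSum≡sum w _ ⟩
  sum (λ i → w i * (f i + g i))           ≡⟨ sum-cong-≗ (λ i → *-distribˡ-+ (w i) (f i) (g i)) ⟩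
  sum (λ i → w i * f i + w i * g i)       ≡⟨ ∑-distrib-+ (λ i → w i * f i) (λ i → w i * g i) ⟩
  sum (λ i → w i * f i) + sum (λ i → w i * g i)
    ≡⟨ sym (cong₂ _+_ (weightedSum≡sum w f) (weightedSum≡sum w g)) ⟩
  weightedSum w f + weightedSum w g       ∎
  where open ≡-Reasoning

weightedSum-zero : (w : Fin n → ℕ) → weightedSum w (λ _ → 0) ≡ 0
weightedSum-zero {zero}  w = refl
weightedSum-zero {suc n} w = cong₂ _+_ (*-zeroʳ (w zero)) (weightedSum-zero (w ∘ suc))

single : Fin n → ℕ → Fin n → ℕ
single zero    b zero    = b
single zero    b (suc _) = 0
single (suc i) b zero    = 0
single (suc i) b (suc x) = single i b x

single-diag : (i : Fin n) (b : ℕ) → single i b i ≡ b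
single-diag zero    b = refl
single-diag (suc i) b = single-diag i b

weightedSum-single : (w : Fin n → ℕ) (i : Fin n) (b : ℕ) → weightedSum w (single i b) ≡ b * w i
weightedSum-single {suc n} w zero b = begin
  w zero * b + weightedSum (w ∘ suc) (λ _ → 0) ≡⟨ cong (w zero * b +_) (weightedSum-zero (w ∘ suc)) ⟩
  w zero * b + 0                               ≡⟨ +-identityʳ _ ⟩
  w zero * b                                   ≡⟨ *-comm (w zero) b ⟩
  b * w zero                                   ∎
  where open ≡-Reasoning
weightedSum-single {suc n} w (suc i) b =
  cong₂ _+_ (*-zeroʳ (w zero)) (weightedSum-single (w ∘ suc) i b)

exchange-isSolution : ∀ {w : Fin n → ℕ} {c} {m d e : Fin n → ℕ} → IsSolution w c m →
                      (∀ x → d x ≤ m x) → weightedSum w d ≡ weightedSum w e →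
                      IsSolution w c (λ x → m x ∸ d x + e x)
exchange-isSolution {w = w} {c} {m} {d} {e} m-sol d≤m Σd≡Σe = begin
  weightedSum w (λ x → m x ∸ d x + e x)       ≡⟨ weightedSum-+ w _ e ⟩
  weightedSum w (λ x → m x ∸ d x) + weightedSum w e
    ≡⟨ cong (weightedSum w (λ x → m x ∸ d x) +_) (sym Σd≡Σe) ⟩
  weightedSum w (λ x → m x ∸ d x) + weightedSum w d ≡⟨ weightedSum-+ w _ d ⟨
  weightedSum w (λ x → m x ∸ d x + d x)       ≡⟨ weightedSum-cong w (λ x → m∸n+n≡m (d≤m x)) ⟩
  weightedSum w m                             ≡⟨ m-sol ⟩
  c                                           ∎
  where open ≡-Reasoning

funToFin-cong : ∀ {k l} {f g : Fin k → Fin l} → (∀ x → f x ≡ g x) → funToFin f ≡ funToFin g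
funToFin-cong {zero}  f≗g = refl
funToFin-cong {suc k} f≗g = cong₂ combine (f≗g zero) (funToFin-cong (f≗g ∘ suc))

finToFun-injective : ∀ {k l} {i j : Fin (l ^ k)} → (∀ x → finToFun {l} {k} i x ≡ finToFun j x) → i ≡ j
finToFun-injective {k} {l} {i} {j} i≗j =
  trans (sym (funToFin-finToFin {k} {l} i)) (trans (funToFin-cong i≗j) (funToFin-finToFin {k} {l} j))

¬∀⟶∃¬-least : ∀ {ℓ} (P : Pred (Fin n) ℓ) → Decidable P → ¬ (∀ i → P i) →
              ∃ λ i → ¬ P i × (∀ j → j Fin.< i → P j)
¬∀⟶∃¬-least P P? ¬∀P with ¬∀⟶∃¬-smallest _ P P? ¬∀P
... | i , ¬Pi , P-below = i , ¬Pi , λ j j<i →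
  subst P (toℕ-injective (trans (toℕ-inject (fromℕ< j<i)) (toℕ-fromℕ< j<i))) (P-below (fromℕ< j<i))

2^k≤m⇒k≤⌊log₂m⌋ : ∀ {k m} → 2 ^ k ≤ m → k ≤ ⌊log₂ m ⌋
2^k≤m⇒k≤⌊log₂m⌋ {k} 2^k≤m = subst (_≤ _) (⌊log₂[2^n]⌋≡n k) (⌊log₂⌋-mono-≤ 2^k≤m)

m%n≡o%n⇒o≡m+[o/n∸m/n]*n : ∀ m o n .{{_ : NonZero n}} → m % n ≡ o % n → m / n ≤ o / n →
                           o ≡ m + (o / n ∸ m / n) * n
m%n≡o%n⇒o≡m+[o/n∸m/n]*n m o n m%n≡o%n m/n≤o/n = begin
  o                                           ≡⟨ m≡m%n+[m/n]*n o n ⟩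
  o % n + o / n * n                           ≡⟨ cong₂ (λ r q → r + q * n) (sym m%n≡o%n) (sym (m+[n∸m]≡n m/n≤o/n)) ⟩
  m % n + (m / n + (o / n ∸ m / n)) * n        ≡⟨ cong (m % n +_) (*-distribʳ-+ n (m / n) _) ⟩
  m % n + (m / n * n + (o / n ∸ m / n) * n)    ≡⟨ +-assoc (m % n) (m / n * n) ((o / n ∸ m / n) * n) ⟨
  m % n + m / n * n + (o / n ∸ m / n) * n      ≡⟨ cong (_+ (o / n ∸ m / n) * n) (m≡m%n+[m/n]*n m n) ⟨
  m + (o / n ∸ m / n) * n                     ∎
  where open ≡-Reasoning

≡-mod⇒≡+* : ∀ m o n .{{_ : NonZero n}} → m % n ≡ o % n →
            (∃ λ q → m ≡ o + q * n) ⊎ (∃ λ q → o ≡ m + q * n)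
≡-mod⇒≡+* m o n m%n≡o%n with ≤-total (m / n) (o / n)
... | inj₁ m/n≤o/n = inj₂ (o / n ∸ m / n , m%n≡o%n⇒o≡m+[o/n∸m/n]*n m o n m%n≡o%n m/n≤o/n)
... | inj₂ o/n≤m/n = inj₁ (m / n ∸ o / n , m%n≡o%n⇒o≡m+[o/n∸m/n]*n o m n (sym m%n≡o%n) o/n≤m/n)

x∉p-x : ∀ {x : Fin n} (p : Subset n) → x ∉ p - x
x∉p-x {x = zero}  (s ∷ p) ()
x∉p-x {x = suc x} (s ∷ p) (there x∈p-x) = x∉p-x p x∈p-x

x∈p⇒∣p∣≡1+∣p-x∣ : ∀ {x : Fin n} {p : Subset n} → x ∈ p → ∣ p ∣ ≡ suc ∣ p - x ∣
x∈p⇒∣p∣≡1+∣p-x∣ {p = inside  ∷ p} here        = cong (suc ∘ ∣_∣) (sym (p─⊥≡p p))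
x∈p⇒∣p∣≡1+∣p-x∣ {p = inside  ∷ p} (there x∈p) = cong suc (x∈p⇒∣p∣≡1+∣p-x∣ x∈p)
x∈p⇒∣p∣≡1+∣p-x∣ {p = outside ∷ p} (there x∈p) = x∈p⇒∣p∣≡1+∣p-x∣ x∈p

∈-supp⁻ : ∀ {m : Fin n → ℕ} {x} → x ∈ supp m → 0 < m x
∈-supp⁻ {m = m} {x} x∈supp with m x | trans (sym (lookup∘tabulate (isPos ∘ m) x)) ([]=⇒lookup x∈supp)
... | suc _ | _  = s≤s z≤n
... | zero  | ()

∈-supp⁺ : ∀ {m : Fin n → ℕ} {x} → 0 < m x → x ∈ supp m
∈-supp⁺ {m = m} {x} 0<mx = lookup⇒[]= x (supp m) (trans (lookup∘tabulate (isPos ∘ m) x) (isPos⁺ 0<mx))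
  where
  isPos⁺ : ∀ {b} → 0 < b → isPos b ≡ true
  isPos⁺ {suc _} _ = refl

∣supp∣≡0 : ∀ {m : Fin n → ℕ} → (∀ x → m x ≡ 0) → ∣ supp m ∣ ≡ 0
∣supp∣≡0 {n} {m} m≡0 = trans (cong ∣_∣ (Empty-unique {p = supp m} supp-empty)) (∣⊥∣≡0 n)
  where
  supp-empty : ¬ ∃ λ x → x ∈ supp m
  supp-empty (x , x∈supp) = <-irrefl (sym (m≡0 x)) (∈-supp⁻ x∈supp)

-- The 0/1-vector supported on A that reads off its values along A from f.
spread : (A : Subset n) → (Fin ∣ A ∣ → Fin 2) → Fin n → ℕ
spread (inside  ∷ A) f zero    = toℕ (f zero)
spread (inside  ∷ A) f (suc x) = spread A (f ∘ suc) x
spread (outside ∷ A) f zero    = 0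
spread (outside ∷ A) f (suc x) = spread A f x

spread-injective : (A : Subset n) {f g : Fin ∣ A ∣ → Fin 2} →
                   (∀ x → spread A f x ≡ spread A g x) → ∀ j → f j ≡ g j
spread-injective (inside  ∷ A) f≗g zero    = toℕ-injective (f≗g zero)
spread-injective (inside  ∷ A) f≗g (suc j) = spread-injective A (f≗g ∘ suc) j
spread-injective (outside ∷ A) f≗g j       = spread-injective A (f≗g ∘ suc) j

spread-∉ : (A : Subset n) (f : Fin ∣ A ∣ → Fin 2) {x : Fin n} → x ∉ A → spread A f x ≡ 0
spread-∉ (inside  ∷ A) f {zero}  x∉A = contradiction here x∉A
spread-∉ (inside  ∷ A) f {suc x} x∉A = spread-∉ A (f ∘ suc) (x∉A ∘ there)
spread-∉ (outside ∷ A) f {zero}  x∉A = refl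
spread-∉ (outside ∷ A) f {suc x} x∉A = spread-∉ A f (x∉A ∘ there)

spread-≤1 : (A : Subset n) (f : Fin ∣ A ∣ → Fin 2) (x : Fin n) → spread A f x ≤ 1
spread-≤1 (inside  ∷ A) f zero    = toℕ≤pred[n] (f zero)
spread-≤1 (inside  ∷ A) f (suc x) = spread-≤1 A (f ∘ suc) x
spread-≤1 (outside ∷ A) f zero    = z≤n
spread-≤1 (outside ∷ A) f (suc x) = spread-≤1 A f x

spread-≤ : (A : Subset n) (f : Fin ∣ A ∣ → Fin 2) {m : Fin n → ℕ} →
           (∀ {x} → x ∈ A → 0 < m x) → ∀ x → spread A f x ≤ m x
spread-≤ A f pos x with x ∈? A
... | yes x∈A = ≤-trans (spread-≤1 A f x) (pos x∈A)
... | no  x∉A = subst (_≤ _) (sym (spread-∉ A f x∉A)) z≤n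

m+n≡m⇒n≡0 : ∀ m {n} → m + n ≡ m → n ≡ 0
m+n≡m⇒n≡0 m {n} m+n≡m = +-cancelˡ-≡ m n 0 (trans m+n≡m (sym (+-identityʳ m)))

LexSmallerOrEq : Permutation′ n → (Fin n → ℕ) → (Fin n → ℕ) → Set
LexSmallerOrEq σ A B = (∀ i → B i ≡ A i) ⊎ LexSmaller σ A B

LexSmaller-asym : ∀ {σ : Permutation′ n} {A B} → LexSmaller σ A B → ¬ LexSmaller σ B A
LexSmaller-asym (j , A≡B , B<A) (j′ , B≡A , A<B) with <-cmpᶠ j j′
... | tri< j<j′ _ _ = <-irrefl (B≡A j j<j′) B<A
... | tri≈ _ refl _ = <-asym B<A A<B
... | tri> _ _ j′<j = <-irrefl (A≡B j′ j′<j) A<B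

LexSmallerOrEq-antisym : ∀ {σ : Permutation′ n} {A B} →
                         LexSmallerOrEq σ A B → LexSmallerOrEq σ B A → ∀ i → B i ≡ A i
LexSmallerOrEq-antisym (inj₁ B≗A)  _           = B≗A
LexSmallerOrEq-antisym (inj₂ _)    (inj₁ A≗B)  = sym ∘ A≗B
LexSmallerOrEq-antisym {σ = σ} {A} {B} (inj₂ A<B) (inj₂ B<A) =
  contradiction B<A (LexSmaller-asym {σ = σ} {A} {B} A<B)

LexSmallerOrEq-translate : ∀ {σ : Permutation′ n} {A B d e} → (∀ x → A x + e x ≡ B x + d x) →
                           LexSmallerOrEq σ A B → LexSmallerOrEq σ d e
LexSmallerOrEq-translate {A = A} {d = d} A+e≡B+d (inj₁ B≗A) =
  inj₁ λ x → +-cancelˡ-≡ (A x) _ _ (trans (A+e≡B+d x) (cong (_+ d x) (B≗A x)))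
LexSmallerOrEq-translate {σ = σ} {A} {B} {d} {e} A+e≡B+d (inj₂ (j , A≡B , B<A)) =
  inj₂ (j , d≡e , e<d)
  where
  d≡e : ∀ k → k Fin.< j → d (σ ⟨$⟩ʳ k) ≡ e (σ ⟨$⟩ʳ k)
  d≡e k k<j = sym (+-cancelˡ-≡ (A (σ ⟨$⟩ʳ k)) _ _
    (trans (A+e≡B+d (σ ⟨$⟩ʳ k)) (cong (_+ d (σ ⟨$⟩ʳ k)) (sym (A≡B k k<j)))))
  e<d : e (σ ⟨$⟩ʳ j) < d (σ ⟨$⟩ʳ j)
  e<d = +-cancelˡ-< (B y) _ _ (subst (B y + e y <_) (A+e≡B+d y) (+-monoˡ-< (e y) B<A))
    where y = σ ⟨$⟩ʳ j

LexSmallerOrEq-bump : ∀ {σ : Permutation′ n} {A B i b} → (∀ k → k Fin.< i → A (σ ⟨$⟩ʳ k) ≡ 0) →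
                      B (σ ⟨$⟩ʳ i) ≡ A (σ ⟨$⟩ʳ i) + b → LexSmallerOrEq σ A B → b ≡ 0
LexSmallerOrEq-bump {A = A} _ Bi≡Ai+b (inj₁ B≗A) = m+n≡m⇒n≡0 (A _) (trans (sym Bi≡Ai+b) (B≗A _))
LexSmallerOrEq-bump {A = A} {i = i} {b} zero-before Bi≡Ai+b (inj₂ (j , A≡B , B<A)) with <-cmpᶠ j i
... | tri< j<i _ _ = contradiction (subst (_ <_) (zero-before j j<i) B<A) n≮0
... | tri≈ _ refl _ = contradiction (subst (_< _) Bi≡Ai+b B<A) (m+n≮m _ b)
... | tri> _ _ i<j = m+n≡m⇒n≡0 (A _) (trans (sym Bi≡Ai+b) (sym (A≡B i i<j)))

module LexSmallestSolution {w : Fin n → ℕ} {σ : Permutation′ n} {c} {m : Fin n → ℕ}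
  (m-lexmin : IsLexSmallestSol w σ c m) where

  exchange-lex : ∀ {d e} → (∀ x → d x ≤ m x) → weightedSum w d ≡ weightedSum w e → LexSmallerOrEq σ d e
  exchange-lex {d} {e} d≤m Σd≡Σe =
    LexSmallerOrEq-translate {σ = σ} {m} {λ x → m x ∸ d x + e x} {d} {e} m+e≡B+d
      (proj₂ m-lexmin _ (exchange-isSolution (proj₁ m-lexmin) d≤m Σd≡Σe))
    where
    m+e≡B+d : ∀ x → m x + e x ≡ m x ∸ d x + e x + d x
    m+e≡B+d x = sym (trans (cong (_+ d x) (sym (+-∸-comm (e x) (d≤m x))))
                           (m∸n+n≡m (≤-trans (d≤m x) (m≤m+n (m x) (e x)))))

  equal-sums⇒≗ : ∀ {d e} → (∀ x → d x ≤ m x) → (∀ x → e x ≤ m x) →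
                 weightedSum w d ≡ weightedSum w e → ∀ x → e x ≡ d x
  equal-sums⇒≗ {d} {e} d≤m e≤m Σd≡Σe =
    LexSmallerOrEq-antisym {σ = σ} {d} {e} (exchange-lex d≤m Σd≡Σe) (exchange-lex e≤m (sym Σd≡Σe))

  module FirstSupportIndex (i : Fin n) (zero-before-i : ∀ k → k Fin.< i → m (σ ⟨$⟩ʳ k) ≡ 0) where

    p : Fin n
    p = σ ⟨$⟩ʳ i

    -- Adding b copies of item p to the exchange gives another solution; it exceeds
    -- m at the σ-first support index i unless b = 0.
    no-bump : ∀ {d e b} → (∀ x → d x ≤ m x) → d p ≡ 0 → e p ≡ 0 →
              weightedSum w d ≡ weightedSum w e + b * w p → b ≡ 0
    no-bump {d} {e} {b} d≤m dp≡0 ep≡0 Σd≡Σe+bw =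
      LexSmallerOrEq-bump {σ = σ} {m} {B} zero-before-i Bp≡mp+b
        (proj₂ m-lexmin B (exchange-isSolution (proj₁ m-lexmin) d≤m Σd≡Σe′))
      where
      e′ B : Fin n → ℕ
      e′ x = e x + single p b x
      B x = m x ∸ d x + e′ x
      Σd≡Σe′ : weightedSum w d ≡ weightedSum w e′
      Σd≡Σe′ = trans Σd≡Σe+bw
        (sym (trans (weightedSum-+ w e (single p b)) (cong (weightedSum w e +_) (weightedSum-single w p b))))
      Bp≡mp+b : B p ≡ m p + b
      Bp≡mp+b rewrite dp≡0 | ep≡0 | single-diag p b = refl

    bumped-sums-equal : ∀ {d e} b → (∀ x → d x ≤ m x) → d p ≡ 0 → e p ≡ 0 →
                        weightedSum w d ≡ weightedSum w e + b * w p → weightedSum w d ≡ weightedSum w e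
    bumped-sums-equal b d≤m dp≡0 ep≡0 Σd≡Σe+bw with no-bump {b = b} d≤m dp≡0 ep≡0 Σd≡Σe+bw
    ... | refl = trans Σd≡Σe+bw (+-identityʳ _)

    ≡-mod⇒≗ : .{{_ : NonZero (w p)}} → ∀ {d e} → (∀ x → d x ≤ m x) → (∀ x → e x ≤ m x) →
              d p ≡ 0 → e p ≡ 0 → weightedSum w d % w p ≡ weightedSum w e % w p → ∀ x → e x ≡ d x
    ≡-mod⇒≗ d≤m e≤m dp≡0 ep≡0 Σd≡Σe with ≡-mod⇒≡+* _ _ (w p) Σd≡Σe
    ... | inj₁ (q , Σd≡Σe+qw) = equal-sums⇒≗ d≤m e≤m (bumped-sums-equal q d≤m dp≡0 ep≡0 Σd≡Σe+qw)
    ... | inj₂ (q , Σe≡Σd+qw) = equal-sums⇒≗ d≤m e≤m (sym (bumped-sums-equal q e≤m ep≡0 dp≡0 Σe≡Σd+qw))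

    A : Subset n
    A = supp m - p

    spread-≤m : (f : Fin ∣ A ∣ → Fin 2) → ∀ x → spread A f x ≤ m x
    spread-≤m f = spread-≤ A f (∈-supp⁻ ∘ p─q⊆p (supp m) ⁅ p ⁆)

    spread-p : (f : Fin ∣ A ∣ → Fin 2) → spread A f p ≡ 0
    spread-p f = spread-∉ A f (x∉p-x (supp m))

    subsetResidue : .{{_ : NonZero (w p)}} → Fin (2 ^ ∣ A ∣) → Fin (w p)
    subsetResidue j = weightedSum w (spread A (finToFun j)) mod w p

    subsetResidue-injective : .{{_ : NonZero (w p)}} → ∀ {j j′} → subsetResidue j ≡ subsetResidue j′ → j ≡ j′
    subsetResidue-injective {j} {j′} eq = finToFun-injective (spread-injective A
      (≡-mod⇒≗ (spread-≤m (finToFun j′)) (spread-≤m (finToFun j)) (spread-p _) (spread-p _) residues))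
      where
      residues : weightedSum w (spread A (finToFun j′)) % w p ≡ weightedSum w (spread A (finToFun j)) % w p
      residues = trans (sym (toℕ-fromℕ< _)) (trans (cong toℕ (sym eq)) (toℕ-fromℕ< _))

    ∣supp∣≤ : ∀ {u} → 0 < w p → w p ≤ u → 0 < m p → ∣ supp m ∣ ≤ ⌊log₂ u ⌋ + 1
    ∣supp∣≤ {u} 0<wp wp≤u 0<mp = begin
      ∣ supp m ∣     ≡⟨ x∈p⇒∣p∣≡1+∣p-x∣ {p = supp m} (∈-supp⁺ {m = m} 0<mp) ⟩
      suc ∣ A ∣      ≤⟨ s≤s (2^k≤m⇒k≤⌊log₂m⌋ (≤-trans (injective⇒≤ subsetResidue-injective) wp≤u)) ⟩
      suc ⌊log₂ u ⌋  ≡⟨ +-comm 1 ⌊log₂ u ⌋ ⟩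
      ⌊log₂ u ⌋ + 1  ∎
      where
      open ≤-Reasoning
      instance
        w-nonZero : NonZero (w p)
        w-nonZero = >-nonZero 0<wp

support-bound : ∀ {n u} {w : Fin n → ℕ} {σ c m} → (∀ i → 1 ≤ w i × w i ≤ u) →
                IsLexSmallestSol w σ c m → ∣ supp m ∣ ≤ ⌊log₂ u ⌋ + 1
support-bound {w = w} {σ} {c} {m} w-bounds m-lexmin with all? (λ k → m (σ ⟨$⟩ʳ k) ≟ 0)
... | yes m∘σ≡0 = subst (_≤ _) (sym (∣supp∣≡0 m≡0)) z≤n
  where
  m≡0 : ∀ x → m x ≡ 0
  m≡0 x = subst (λ y → m y ≡ 0) (inverseʳ σ) (m∘σ≡0 (σ ⟨$⟩ˡ x))
... | no m∘σ≢0 with ¬∀⟶∃¬-least _ (λ k → m (σ ⟨$⟩ʳ k) ≟ 0) m∘σ≢0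
...   | i , mi≢0 , zero-before-i =
  FirstSupportIndex.∣supp∣≤ i zero-before-i (proj₁ (w-bounds _)) (proj₂ (w-bounds _)) (n≢0⇒n>0 mi≢0)
  where open LexSmallestSolution {w = w} {σ} {c} {m} m-lexmin

corollary5 : (n u : ℕ) (w : Fin n → ℕ) → (∀ i → 1 ≤ w i × w i ≤ u) → (σ : Permutation′ n)
    → ((j : ℕ) → Feasible w j → (m : Fin n → ℕ) → IsLexSmallestSol w σ j m
         → ∣ supp m ∣ ≤ ⌊log₂ u ⌋ + 1)
    × ((pos : 0 < n) → (r : ℕ) → r < w (fromℕ< pos)
         → (∃ λ t → Feasible w t × ∃ λ q → t ≡ r + q * w (fromℕ< pos))
         → (s : ℕ) → Feasible w s → (∃ λ q → s ≡ r + q * w (fromℕ< pos))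
         → ((t : ℕ) → Feasible w t → (∃ λ q → t ≡ r + q * w (fromℕ< pos)) → s ≤ t)
         → (m : Fin n → ℕ) → IsLexSmallestSol w σ s m
         → ∣ supp m ∣ ≤ ⌊log₂ u ⌋ + 1)
corollary5 n u w w-bounds σ =
  (λ j _ m → support-bound {σ = σ} {j} {m} w-bounds) ,
  (λ _ _ _ _ s _ _ _ m → support-bound {σ = σ} {s} {m} w-bounds)
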